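{- Let $\mathrm{WI} = (\Sigma, d, D, W, g)$ be a Wordle instance, $C \subseteq W$ a nonempty set of words, and $1 \le \ell \le g$. Define the recursive procedure $\mathrm{solvable}(C, D, \ell)$ as follows: if $\ell = 1$ and $|C| > 1$, return false; if $|C| = 1$, return true; otherwise, return true if there exists $u \in D$ such that for every $w \in C$, the call $\mathrm{solvable}(A_{w,u}, D, \ell-1)$ returns true, where $A_{w,u} = \{ v \in C : \Omega_v(u) = \Omega_w(u)\}$; and return false otherwise. Then $\mathrm{solvable}(C, D, \ell)$ returns true if and only if the instance $(\Sigma, d, D, C, \ell)$ admits a winning strategy. In particular, $\mathrm{WI}$ admits a winning strategy if and only if $\mathrm{solvable}(W, D, g)$ returns true.
   Context: A Wordle instance $\mathrm{WI} = (\Sigma, d, D, W, g)$ consists of a finite alphabet $\Sigma$, a dimension $d \in \mathbf{Z}^+$, a dictionary $D \subseteq \Sigma^d$, a word list $W \subseteq D$, and a game length $g \in \mathbf{Z}^+$. For $w \in W$ and $u \in D$, the Wordle oracle returns $\Omega_w(u) = r \in \{0,1,2\}^d$ with $r_i = 2$ if $w_i = u_i$; $r_i = 1$ if otherwise $|\{ j \le i : u_i = u_j,\ u_j \ne w_j\}| \le |\{ j : w_j = u_i,\ w_j \ne u_j\}|$; $r_i = 0$ otherwise. A strategy is a function that, for every finite sequence of queries and responses $u^1, r^1, \dots, u^{k-1}, r^{k-1}$, specifies a next query $u^k \in D$. Playing against $\Omega_w$ (responses $r^i = \Omega_w(u^i)$), the strategy succeeds in round $k$ if $\Omega_w(u^k)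 = 22\cdots2$. A strategy is winning for an instance with word list $W'$ and game length $g'$ if for every $w \in W'$ it succeeds in at most $g'$ rounds against $\Omega_w$. -}

module Defs where

open import Data.Nat using (ℕ; zero; suc; _≤_; _≤ᵇ_; _<ᵇ_; _≡ᵇ_)
open import Data.Nat.Properties using (_≤?_)
open import Data.Bool using (Bool; true; false; if_then_else_; _∧_)
open import Data.Fin using (Fin; toℕ)
open import Data.Fin.Properties renaming (_≟_ to _≟F_)
open import Data.Vec using (Vec; lookup; tabulate; replicate)
open import Data.Vec.Properties using (≡-dec)
open import Data.List using (List; []; _∷_; _++_; [_]; length; filter)
open import Data.Bool.ListAction using (any; all)
open import Data.List.Membership.Propositional using (_∈_)
open import Data.Product using (Σ; _×_; _,_; ∃; ∃-syntax)
open import Relation.Nullary using (¬_; Dec; yes; no)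
open import Relation.Nullary.Decidable using (_×-dec_; ¬?; ⌊_⌋)
open import Relation.Binary.PropositionalEquality using (_≡_)

Word : ℕ → ℕ → Set
Word k d = Vec (Fin k) d

Response : ℕ → Set
Response d = Vec (Fin 3) d

_≟W_ : ∀ {k d} → (u v : Word k d) → Dec (u ≡ v)
_≟W_ = ≡-dec _≟F_

_≟R_ : ∀ {d} → (r s : Response d) → Dec (r ≡ s)
_≟R_ = ≡-dec _≟F_

private
  allIdx : (d : ℕ) → List (Fin d)
  allIdx d = Data.List.allFin d
    where import Data.List

countIdx : (d : ℕ) → (Fin d → Bool) → ℕ
countIdx d P = length (filter (λ j → Data.Bool._≟_ (P j) true) (allIdx d))
  where import Data.Bool

-- The Wordle oracle Ω_w(u):
--  r_i = 2 if w_i = u_i;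
--  r_i = 1 if otherwise |{ j ≤ i : u_j = u_i, u_j ≠ w_j }| ≤ |{ j : w_j = u_i, w_j ≠ u_j }|;
--  r_i = 0 otherwise.
Ω : ∀ {k d} → Word k d → Word k d → Response d
Ω {k} {d} w u = tabulate resp
  where
    resp : Fin d → Fin 3
    resp i with lookup w i ≟F lookup u i
    ... | yes _ = Fin.suc (Fin.suc Fin.zero)
    ... | no _ =
      if countIdx d (λ j → (toℕ j ≤ᵇ toℕ i)
                          ∧ ⌊ lookup u j ≟F lookup u i ⌋
                          ∧ ⌊ ¬? (lookup u j ≟F lookup w j) ⌋)
         ≤ᵇ countIdx d (λ j → ⌊ lookup w j ≟F lookup u i ⌋
                            ∧ ⌊ ¬? (lookup w j ≟F lookup u j) ⌋)
      then Fin.suc Fin.zero else Fin.zero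
      where import Data.Fin as Fin

allGreen : ∀ d → Response d
allGreen d = replicate d (Data.Fin.suc (Data.Fin.suc Data.Fin.zero))

-- Histories: finite sequences u¹,r¹,…,u^{k-1},r^{k-1} (chronological order).
History : ℕ → ℕ → Set
History k d = List (Word k d × Response d)

Strategy : ∀ {k d} → List (Word k d) → Set
Strategy {k} {d} D = Σ (History k d → Word k d) (λ s → ∀ h → s h ∈ D)

history : ∀ {k d} → (History k d → Word k d) → Word k d → ℕ → History k d
history s w zero = []
history s w (suc n) = history s w n ++ [ (s (history s w n) , Ω w (s (history s w n))) ]

-- The query made in round n+1.
query : ∀ {k d} → (History k d → Word k d) → Word k d → ℕ → Word k d
query s w n = s (history s w n)

SucceedsIn : ∀ {k d} → (History k d → Word k d) → Word k d → ℕ → Set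
SucceedsIn s w zero = Data.Empty.⊥
  where import Data.Empty
SucceedsIn {d = d} s w (suc n) = Ω w (query s w n) ≡ allGreen d

IsWinning : ∀ {k d} {D : List (Word k d)} → Strategy D → List (Word k d) → ℕ → Set
IsWinning (s , _) W' g' = ∀ w → w ∈ W' → ∃[ m ] (m ≤ g' × SucceedsIn s w m)

AdmitsWinningStrategy : ∀ {k d} → List (Word k d) → List (Word k d) → ℕ → Set
AdmitsWinningStrategy D W' g' = Σ (Strategy D) (λ σ → IsWinning σ W' g')

A : ∀ {k d} → Word k d → Word k d → List (Word k d) → List (Word k d)
A w u C = filter (λ v → Ω v u ≟R Ω w u) C

-- The recursive procedure solvable(C, D, ℓ).  The case ℓ = 0 is never reached
-- from a call with ℓ ≥ 1 and C nonempty; it is set to false by convention.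
solvable : ∀ {k d} → List (Word k d) → List (Word k d) → ℕ → Bool
solvable C D zero = false
solvable C D (suc ℓ) =
  if (ℓ ≡ᵇ 0) ∧ (1 <ᵇ length C) then false
  else if length C ≡ᵇ 1 then true
  else any (λ u → all (λ w → solvable (A w u C) D ℓ) C) D

{-# OPTIONS --safe #-}
-- solvable mirrors the game tree.  A strategy winning on C within ℓ + 2 rounds is
-- exactly a first query u ∈ D together with, for every response, a strategy winning
-- within ℓ + 1 rounds on the class A w u C of words giving that response; the class of
-- the all-green response is {u} and is won at once.  The base cases are |C| = 1 (guess
-- the word) and ℓ = 1 (one guess identifies at most one word); uniqueness of C makes the
-- length test |C| > 1 mean that C contains two distinct words.
module Submission where

open import Defs
open import Data.Nat using (ℕ; zero; suc; _≤_; z≤n; s≤s)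
open import Data.Nat.Properties using (≤-refl)
open import Data.Bool using (Bool; true; false; if_then_else_)
open import Data.Bool.ListAction using (any; all)
open import Data.Bool.Properties using (T-≡)
open import Data.Empty using (⊥-elim)
open import Data.Fin using (Fin)
import Data.Fin as Fin
open import Data.Fin.Properties using () renaming (_≟_ to _≟F_)
open import Data.List using (List; []; _∷_; [_])
open import Data.List.Membership.Propositional using (_∈_; find; lose)
open import Data.List.Membership.Propositional.Properties using (∈-filter⁺; ∈-filter⁻)
open import Data.List.Relation.Binary.Subset.Propositional using (_⊆_)
open import Data.List.Relation.Unary.All using (All; _∷_)
import Data.List.Relation.Unary.All as All
open import Data.List.Relation.Unary.All.Properties using (all⁺; all⁻)
open import Data.List.Relation.Unary.AllPairs using (_∷_)
open import Data.List.Relation.Unary.Any using (Any; here; there; any?)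
open import Data.List.Relation.Unary.Any.Properties using (any⇔)
open import Data.List.Relation.Unary.Unique.Propositional using (Unique)
import Data.List.Relation.Unary.Unique.Propositional.Properties as Unique
open import Data.Product using (∃-syntax; _×_; _,_; proj₁; proj₂)
open import Data.Vec using (lookup)
open import Data.Vec.Properties using (lookup∘tabulate; lookup-replicate)
open import Data.Vec.Relation.Binary.Pointwise.Extensional using (ext; Pointwise-≡⇒≡)
open import Function using (_∘_; id; const; case_of_)
open import Function.Bundles using (_⇔_; mk⇔; Equivalence)
open import Function.Properties.Equivalence using () renaming (sym to ⇔-sym)
open import Function.Related.Propositional using (module EquationalReasoning)
open import Relation.Nullary using (¬_; Dec; yes; no)
open import Relation.Binary.PropositionalEquality using (_≡_; _≢_; refl; sym; trans; cong; subst)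

green : Fin 3
green = Fin.suc (Fin.suc Fin.zero)

module _ {k d : ℕ} (w u : Word k d) (i : Fin d) where

  Ω-green-at : lookup (Ω w u) i ≡ green ⇔ lookup w i ≡ lookup u i
  Ω-green-at = mk⇔ to from
    where
    to : lookup (Ω w u) i ≡ green → lookup w i ≡ lookup u i
    to p with trans (sym (lookup∘tabulate _ i)) p
    ... | q with lookup w i ≟F lookup u i
    ... | yes wᵢ≡uᵢ = wᵢ≡uᵢ
    ... | no _ = ⊥-elim (amber-or-grey≢green _ q)
      where
      amber-or-grey≢green : ∀ b → ¬ ((if b then Fin.suc Fin.zero else Fin.zero) ≡ green)
      amber-or-grey≢green true ()
      amber-or-grey≢green false ()

    from : lookup w i ≡ lookup u i → lookup (Ω w u) i ≡ green
    from wᵢ≡uᵢ with trans (sym (lookup∘tabulate _ i)) (refl {x = lookup (Ω w u) i})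
    ... | q with lookup w i ≟F lookup u i
    ... | yes _ = sym q
    ... | no wᵢ≢uᵢ = ⊥-elim (wᵢ≢uᵢ wᵢ≡uᵢ)

Ω≡allGreen⇔≡ : ∀ {k d} (w u : Word k d) → Ω w u ≡ allGreen d ⇔ w ≡ u
Ω≡allGreen⇔≡ {d = d} w u = mk⇔
  (λ Ωwu≡green → Pointwise-≡⇒≡ (ext λ i → Equivalence.to (Ω-green-at w u i)
    (trans (cong (λ r → lookup r i) Ωwu≡green) (lookup-replicate i green))))
  (λ { refl → Pointwise-≡⇒≡ (ext λ i →
    trans (Equivalence.from (Ω-green-at w w i) refl) (sym (lookup-replicate i green))) })

any-all≡true⇔ : ∀ {A B : Set} (p : A → B → Bool) (xs : List A) (ys : List B) →
  any (λ x → all (p x) ys) xs ≡ true ⇔ (∃[ x ] (x ∈ xs × ∀ {y} → y ∈ ys → p x y ≡ true))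
any-all≡true⇔ p xs ys = mk⇔ to from
  where
  to : any (λ x → all (p x) ys) xs ≡ true → ∃[ x ] (x ∈ xs × ∀ {y} → y ∈ ys → p x y ≡ true)
  to h with find (Equivalence.from any⇔ (Equivalence.from T-≡ h))
  ... | x , x∈xs , T-all = x , x∈xs ,
        λ y∈ys → Equivalence.to T-≡ (All.lookup (all⁺ (p x) ys T-all) y∈ys)

  from : ∃[ x ] (x ∈ xs × ∀ {y} → y ∈ ys → p x y ≡ true) → any (λ x → all (p x) ys) xs ≡ true
  from (x , x∈xs , h) = Equivalence.to T-≡ (Equivalence.to any⇔
    (lose x∈xs (all⁻ (p x) (All.tabulate (Equivalence.from T-≡ ∘ h)))))

module Game {k d : ℕ} where

  Play : Set
  Play = History k d → Word k d

  WinsWithin : Play → Word k d → ℕ → Set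
  WinsWithin s w n = ∃[ m ] (m ≤ n × SucceedsIn s w m)

  _after_ : Play → Word k d × Response d → Play
  (s after ur) h = s (ur ∷ h)

  _▷_ : Word k d → (Response d → Play) → Play
  (u ▷ σ) []             = u
  (u ▷ σ) ((_ , r) ∷ h) = σ r h

  history-after : ∀ (s : Play) v {r} → Ω v (s []) ≡ r → ∀ n →
    history s v (suc n) ≡ (s [] , r) ∷ history (s after (s [] , r)) v n
  history-after s v refl zero = refl
  history-after s v refl (suc n) rewrite history-after s v refl n = refl

  succeedsIn-after : ∀ (s : Play) v {r} → Ω v (s []) ≡ r → ∀ n →
    SucceedsIn s v (suc (suc n)) ⇔ SucceedsIn (s after (s [] , r)) v (suc n)
  succeedsIn-after s v e n =
    mk⇔ (subst P (history-after s v e n)) (subst P (sym (history-after s v e n)))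
    where
    P : History k d → Set
    P h = Ω v (s h) ≡ allGreen d

  winsWithin-after⁺ : ∀ (s : Play) v {r} → Ω v (s []) ≡ r → ∀ {n} →
    WinsWithin (s after (s [] , r)) v n → WinsWithin s v (suc n)
  winsWithin-after⁺ s v e (suc m , m<n , win) =
    suc (suc m) , s≤s m<n , Equivalence.from (succeedsIn-after s v e m) win

  winsWithin-after⁻ : ∀ (s : Play) v {r} → Ω v (s []) ≡ r → r ≢ allGreen d → ∀ {n} →
    WinsWithin s v (suc n) → WinsWithin (s after (s [] , r)) v n
  winsWithin-after⁻ s v e r≢green (suc zero , _ , win) = ⊥-elim (r≢green (trans (sym e) win))
  winsWithin-after⁻ s v e r≢green (suc (suc m) , s≤s m≤n , win) =
    suc m , m≤n , Equivalence.to (succeedsIn-after s v e m) win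

  winsWithin-1⇒≡first : ∀ (s : Play) v → WinsWithin s v 1 → v ≡ s []
  winsWithin-1⇒≡first s v (suc zero , _ , win) = Equivalence.to (Ω≡allGreen⇔≡ v (s [])) win
  winsWithin-1⇒≡first s v (suc (suc _) , s≤s () , _)

module _ {k d : ℕ} where

  ∈A⇒Ω≡ : {v w u : Word k d} {C : List (Word k d)} → v ∈ A w u C → Ω v u ≡ Ω w u
  ∈A⇒Ω≡ {w = w} {u} {C} = proj₂ ∘ ∈-filter⁻ (λ v → Ω v u ≟R Ω w u) {xs = C}

  ∈A⇒∈ : {v w u : Word k d} {C : List (Word k d)} → v ∈ A w u C → v ∈ C
  ∈A⇒∈ {w = w} {u} {C} = proj₁ ∘ ∈-filter⁻ (λ v → Ω v u ≟R Ω w u) {xs = C}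

  ∈⇒∈A : {v w u : Word k d} {C : List (Word k d)} → v ∈ C → Ω v u ≡ Ω w u → v ∈ A w u C
  ∈⇒∈A {w = w} {u} = ∈-filter⁺ (λ v → Ω v u ≟R Ω w u)

module _ {k d : ℕ} (D : List (Word k d)) where
  open Game

  Admits : List (Word k d) → ℕ → Set
  Admits = AdmitsWinningStrategy D

  admits-singleton : ∀ {x} → x ∈ D → ∀ n → Admits [ x ] (suc n)
  admits-singleton {x} x∈D n = (const x , const x∈D) ,
    λ { _ (here refl) → 1 , s≤s z≤n , Equivalence.from (Ω≡allGreen⇔≡ x x) refl }

  ¬admits-1 : ∀ {x y C} → x ≢ y → x ∈ C → y ∈ C → ¬ Admits C 1
  ¬admits-1 x≢y x∈C y∈C ((s , _) , win) =
    x≢y (trans (winsWithin-1⇒≡first s _ (win _ x∈C)) (sym (winsWithin-1⇒≡first s _ (win _ y∈C))))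

  admits-by-first-query : ∀ {u C n} → u ∈ D → (∀ {w} → w ∈ C → Admits (A w u C) n) →
    Admits C (suc n)
  admits-by-first-query {u} {C} {n} u∈D S =
    (u ▷ (proj₁ ∘ σ) , ▷∈D) ,
    λ v v∈C → winsWithin-after⁺ (u ▷ (proj₁ ∘ σ)) v refl (respond-wins v∈C (δ (Ω v u)))
    where
    δ : (r : Response d) → Dec (Any (λ w → Ω w u ≡ r) C)
    δ r = any? (λ w → Ω w u ≟R r) C

    winner : ∀ {r} → ∃[ w ] (w ∈ C × Ω w u ≡ r) → Strategy D
    winner (_ , w∈C , _) = proj₁ (S w∈C)

    respond : ∀ r → Dec (Any (λ w → Ω w u ≡ r) C) → Strategy D
    respond r (yes some-w) = winner (find some-w)
    respond r (no _)       = const u , const u∈D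

    σ : Response d → Strategy D
    σ r = respond r (δ r)

    ▷∈D : ∀ h → (u ▷ (proj₁ ∘ σ)) h ∈ D
    ▷∈D []            = u∈D
    ▷∈D ((_ , r) ∷ h) = proj₂ (σ r) h

    respond-wins : ∀ {v} → v ∈ C → (x : Dec (Any (λ w → Ω w u ≡ Ω v u) C)) →
      WinsWithin (proj₁ (respond (Ω v u) x)) v n
    respond-wins {v} v∈C (yes some-w) with find some-w
    ... | w , w∈C , Ωwu≡Ωvu = proj₂ (S w∈C) v (∈⇒∈A {w = w} v∈C (sym Ωwu≡Ωvu))
    respond-wins v∈C (no none) = ⊥-elim (none (lose v∈C refl))

  admits-after-first-query : ∀ {C n} (σ : Strategy D) → IsWinning σ C (suc (suc n)) →
    ∀ {w} → w ∈ C → Admits (A w (proj₁ σ []) C) (suc n)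
  admits-after-first-query {C} (s , s∈D) win {w} w∈C with Ω w (s []) ≟R allGreen d
  ... | yes Ωw≡green = (const (s []) , const (s∈D [])) ,
        λ v v∈A → 1 , s≤s z≤n , trans (∈A⇒Ω≡ {w = w} {C = C} v∈A) Ωw≡green
  ... | no Ωw≢green = (s after (s [] , Ω w (s [])) , λ h → s∈D _) ,
        λ v v∈A → winsWithin-after⁻ s v (∈A⇒Ω≡ {w = w} {C = C} v∈A) Ωw≢green
                    (win v (∈A⇒∈ {w = w} {C = C} v∈A))

  admits-2+⇔ : ∀ {C n} →
    Admits C (suc (suc n)) ⇔ (∃[ u ] (u ∈ D × ∀ {w} → w ∈ C → Admits (A w u C) (suc n)))
  admits-2+⇔ = mk⇔
    (λ { (σ , win) → proj₁ σ [] , proj₂ σ [] , admits-after-first-query σ win })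
    (λ { (u , u∈D , S) → admits-by-first-query u∈D S })

  solvable-singleton : ∀ x ℓ → solvable [ x ] D (suc ℓ) ≡ true
  solvable-singleton x zero    = refl
  solvable-singleton x (suc ℓ) = refl

  solvable⇔admits : ∀ ℓ C → Unique C → C ≢ [] → C ⊆ D →
    solvable C D (suc ℓ) ≡ true ⇔ Admits C (suc ℓ)
  solvable⇔admits ℓ [] _ C≢[] _ = ⊥-elim (C≢[] refl)
  solvable⇔admits ℓ (x ∷ []) _ _ C⊆D =
    mk⇔ (λ _ → admits-singleton (C⊆D (here refl)) ℓ) (λ _ → solvable-singleton x ℓ)
  solvable⇔admits zero (x ∷ y ∷ _) ((x≢y ∷ _) ∷ _) _ _ =
    mk⇔ (λ ()) (⊥-elim ∘ ¬admits-1 x≢y (here refl) (there (here refl)))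
  solvable⇔admits (suc n) C@(_ ∷ _ ∷ _) C-unique _ C⊆D = begin
    solvable C D (suc (suc n)) ≡ true
      ∼⟨ any-all≡true⇔ (λ u w → solvable (A w u C) D (suc n)) D C ⟩
    (∃[ u ] (u ∈ D × ∀ {w} → w ∈ C → solvable (A w u C) D (suc n) ≡ true))
      ∼⟨ mk⇔ (λ (u , u∈D , h) → u , u∈D , λ w∈C → Equivalence.to (IH w∈C) (h w∈C))
             (λ (u , u∈D , h) → u , u∈D , λ w∈C → Equivalence.from (IH w∈C) (h w∈C)) ⟩
    (∃[ u ] (u ∈ D × ∀ {w} → w ∈ C → Admits (A w u C) (suc n)))
      ∼⟨ ⇔-sym admits-2+⇔ ⟩
    Admits C (suc (suc n)) ∎
    where
    open EquationalReasoning

    IH : ∀ {u w} → w ∈ C → solvable (A w u C) D (suc n) ≡ true ⇔ Admits (A w u C) (suc n)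
    IH {u} {w} w∈C = solvable⇔admits n (A w u C)
      (Unique.filter⁺ (λ v → Ω v u ≟R Ω w u) C-unique)
      (λ A≡[] → case subst (w ∈_) A≡[] (∈⇒∈A {w = w} w∈C refl) of λ ())
      (C⊆D ∘ ∈A⇒∈ {w = w} {C = C})

lemma3p3 : (k d : ℕ) → 1 ≤ d → (D W : List (Word k d)) → (g : ℕ) → 1 ≤ g
    → All (_∈ D) W
    → ((C : List (Word k d)) → Unique C → C ≢ [] → C ⊆ W
        → (ℓ : ℕ) → 1 ≤ ℓ → ℓ ≤ g
        → (solvable C D ℓ ≡ true ⇔ AdmitsWinningStrategy D C ℓ))
      × (Unique W → W ≢ [] → (solvable W D g ≡ true ⇔ AdmitsWinningStrategy D W g))
lemma3p3 k d _ D W g 1≤g W⊆D =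
  every-subset , λ W-unique W≢[] → every-subset W W-unique W≢[] id g 1≤g ≤-refl
  where
  every-subset : (C : List (Word k d)) → Unique C → C ≢ [] → C ⊆ W → (ℓ : ℕ) → 1 ≤ ℓ → ℓ ≤ g →
    solvable C D ℓ ≡ true ⇔ AdmitsWinningStrategy D C ℓ
  every-subset C C-unique C≢[] C⊆W (suc ℓ) _ _ =
    solvable⇔admits D ℓ C C-unique C≢[] (All.lookup W⊆D ∘ C⊆W)
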